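{- For every sequence $(s_k)_{k\ge1}$ of positive integers, the set of words $\mathcal{P}^{(s_k)}$ is well-quasi-ordered under the factor order, i.e. it contains no infinite antichain with respect to the relation "$u$ is a factor of $w$".
   Context: A factor of a word is a contiguous subword. Binary words: the complement of $\gamma_1\cdots\gamma_n$ is $(1-\gamma_1)\cdots(1-\gamma_n)$. For a sequence $(s_k)$ of positive integers set $\alpha^{(s_k)}_1=01$ and $\alpha^{(s_k)}_{i+1}=(\alpha^{(s_k)}_i)^{s_i}(\overline{\alpha}^{(s_k)}_i)^{s_i}$; $\mathcal{L}^{(s_k)}$ is the set of factors (including the empty word) of the words $\alpha^{(s_k)}_i$, $i\ge1$. Let $\rho:\{0,1\}^*\to\{\mathsf{u},\mathsf{d},\mathsf{r_u},\mathsf{r_d}\}^*$ be the morphism $0\mapsto\mathsf{d}\mathsf{r_d}$, $1\mapsto\mathsf{u}\mathsf{r_u}$, and let $\mathcal{P}^{(s_k)}$ be the set of all factors of words $\rho(x)$ with $x\in\mathcal{L}^{(s_k)}$. -}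

module Defs where

open import Data.Nat using (ℕ; zero; suc; _≤_)
open import Data.List using (List; []; _∷_; _++_; map; concat; concatMap; replicate)
open import Data.Product using (Σ; ∃; _×_)
open import Relation.Binary.PropositionalEquality using (_≡_; _≢_)
open import Relation.Nullary using (¬_)

data Bin : Set where
  b0 b1 : Bin

data Step : Set where
  u d ru rd : Step

Factor : {A : Set} → List A → List A → Set
Factor {A} v w = Σ (List A) λ p → Σ (List A) λ q → p ++ v ++ q ≡ w

compl : List Bin → List Bin
compl = map λ { b0 → b1 ; b1 → b0 }

pow : {A : Set} → ℕ → List A → List A
pow n w = concat (replicate n w)

-- alphaW s n = α^{(s_k)}_{n+1}  (the paper indexes α and s from 1;
-- s is given as a function ℕ → ℕ whose value at 0 is irrelevant)
--   α_1 = 01,   α_{i+1} = α_i^{s_i} (ᾱ_i)^{s_i}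
alphaW : (ℕ → ℕ) → ℕ → List Bin
alphaW s zero = b0 ∷ b1 ∷ []
alphaW s (suc n) = pow (s (suc n)) (alphaW s n) ++ pow (s (suc n)) (compl (alphaW s n))

InL : (ℕ → ℕ) → List Bin → Set
InL s x = ∃ λ n → Factor x (alphaW s n)

ρ : List Bin → List Step
ρ = concatMap λ { b0 → d ∷ rd ∷ [] ; b1 → u ∷ ru ∷ [] }

InP : (ℕ → ℕ) → List Step → Set
InP s w = Σ (List Bin) λ x → InL s x × Factor w (ρ x)

InfiniteAntichainP : (ℕ → ℕ) → Set
InfiniteAntichainP s =
  Σ (ℕ → List Step) λ f →
    (∀ i → InP s (f i)) × (∀ i j → i ≢ j → ¬ Factor (f i) (f j))

{-# OPTIONS --safe #-}
module Submission where

-- Suppose f is an antichain in P, with f 0 a factor of ρ x and x a factor of α_m, and let β = α_{m+1}.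
-- Every α_n with n > m is a concatenation of the blocks β and β̄, and since β = PQ with β̄ = QP,
-- β occurs in any two consecutive blocks. So a word of P that is long compared to |β| spans two
-- blocks and contains ρ β, hence f 0; thus all f (suc j) are short, and among the finitely many
-- short words over {u, d, r_u, r_d} two of them must coincide.

open import Defs
open import Data.Nat using (ℕ; zero; suc; _+_; _*_; _≤_; _≤′_; ≤′-reflexive; ≤′-step; z≤n; s≤s)
open import Data.Nat.Properties
  using (≤-trans; ≤-reflexive; ≤⇒≤′; m≤m+n; n<1+n; +-comm; +-mono-≤; +-monoʳ-≤; *-monoˡ-≤; <⇒≢; suc-injective;
         module ≤-Reasoning)
open import Data.Fin using (toℕ)
open import Data.Fin.Properties using (pigeonhole)
open import Data.List using (List; []; _∷_; _++_; concatMap; length; lookup; cartesianProductWith)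
open import Data.List.Properties
  using (∷-injective; ++-assoc; ++-identityʳ; length-++; length-++-≤ˡ; length-++-≤ʳ; length-map; map-++; concatMap-++)
open import Data.List.Membership.Propositional using (_∈_)
open import Data.List.Membership.Propositional.Properties using (∈-cartesianProductWith⁺)
open import Data.List.Relation.Unary.Any using (here; there; index)
open import Data.List.Relation.Unary.Any.Properties using (lookup-index)
open import Data.Empty using (⊥-elim)
open import Data.Product using (Σ; ∃; ∃₂; _×_; _,_)
open import Data.Sum using (_⊎_; inj₁; inj₂; [_,_]′)
open import Function using (id; _∘_)
open import Relation.Binary.PropositionalEquality
open import Relation.Nullary using (¬_)

module _ {A : Set} where

  ++-equidivisible : (xs ys zs ws : List A) → xs ++ ys ≡ zs ++ ws →
    (∃ λ r → xs ≡ zs ++ r × ws ≡ r ++ ys) ⊎ (∃ λ r → zs ≡ xs ++ r × ys ≡ r ++ ws)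
  ++-equidivisible []       ys zs       ws eq = inj₂ (zs , refl , eq)
  ++-equidivisible (x ∷ xs) ys []       ws eq = inj₁ (x ∷ xs , refl , sym eq)
  ++-equidivisible (x ∷ xs) ys (z ∷ zs) ws eq with ∷-injective eq
  ... | refl , eq′ with ++-equidivisible xs ys zs ws eq′
  ...   | inj₁ (r , e₁ , e₂) = inj₁ (r , cong (x ∷_) e₁ , e₂)
  ...   | inj₂ (r , e₁ , e₂) = inj₂ (r , cong (x ∷_) e₁ , e₂)

  Factor-refl : (xs : List A) → Factor xs xs
  Factor-refl xs = [] , [] , ++-identityʳ xs

  Factor-trans : {xs ys zs : List A} → Factor xs ys → Factor ys zs → Factor xs zs
  Factor-trans {xs} {ys} {zs} (p , q , e) (p′ , q′ , e′) = p′ ++ p , q ++ q′ , (begin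
    (p′ ++ p) ++ xs ++ q ++ q′  ≡⟨ ++-assoc p′ p _ ⟩
    p′ ++ p ++ xs ++ q ++ q′    ≡⟨ cong (λ t → p′ ++ p ++ t) (sym (++-assoc xs q q′)) ⟩
    p′ ++ p ++ (xs ++ q) ++ q′  ≡⟨ cong (p′ ++_) (sym (++-assoc p (xs ++ q) q′)) ⟩
    p′ ++ (p ++ xs ++ q) ++ q′  ≡⟨ cong (λ t → p′ ++ t ++ q′) e ⟩
    p′ ++ ys ++ q′              ≡⟨ e′ ⟩
    zs                          ∎)
    where open ≡-Reasoning

  Factor-++ˡ : (xs ys : List A) → Factor xs (xs ++ ys)
  Factor-++ˡ xs ys = [] , ys , refl

  Factor-++ʳ : (xs ys : List A) → Factor ys (xs ++ ys)
  Factor-++ʳ xs ys = xs , [] , cong (xs ++_) (++-identityʳ ys)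

  Factor-∷ : {xs ys : List A} (y : A) → Factor xs ys → Factor xs (y ∷ ys)
  Factor-∷ y (p , q , e) = y ∷ p , q , cong (y ∷_) e

  Factor-concatMap⁺ : {B : Set} (g : B → List A) {xs ys : List B} →
                      Factor xs ys → Factor (concatMap g xs) (concatMap g ys)
  Factor-concatMap⁺ g {xs} {ys} (p , q , e) = concatMap g p , concatMap g q , (begin
    concatMap g p ++ concatMap g xs ++ concatMap g q  ≡⟨ cong (concatMap g p ++_) (sym (concatMap-++ g xs q)) ⟩
    concatMap g p ++ concatMap g (xs ++ q)            ≡⟨ sym (concatMap-++ g p (xs ++ q)) ⟩
    concatMap g (p ++ xs ++ q)                        ≡⟨ cong (concatMap g) e ⟩
    concatMap g ys                                    ∎)
    where open ≡-Reasoning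

module Blocks {A B : Set} (g : B → List A) {L : ℕ} (uniform : ∀ b → length (g b) ≡ L) where

  length-concatMap : (ys : List B) → length (concatMap g ys) ≡ length ys * L
  length-concatMap []       = refl
  length-concatMap (y ∷ ys) = trans (length-++ (g y)) (cong₂ _+_ (uniform y) (length-concatMap ys))

  length-prefix-of-block : (b : B) {xs ys : List A} → g b ≡ xs ++ ys → length xs ≤ L
  length-prefix-of-block b {xs} {ys} e =
    ≤-trans (length-++-≤ˡ xs {ys}) (≤-reflexive (trans (cong length (sym e)) (uniform b)))

  length-suffix-of-block : (b : B) {xs ys : List A} → g b ≡ xs ++ ys → length ys ≤ L
  length-suffix-of-block b {xs} {ys} e =
    ≤-trans (length-++-≤ʳ ys {xs}) (≤-reflexive (trans (cong length (sym e)) (uniform b)))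

  prefix-of-blocks : (w q : List A) (xs : List B) → w ++ q ≡ concatMap g xs →
    Σ (List B) λ ys → (∃ λ t → ys ++ t ≡ xs) × ∃ λ r → w ≡ concatMap g ys ++ r × length r ≤ L
  prefix-of-blocks []      q xs       e = [] , (xs , refl) , [] , refl , z≤n
  prefix-of-blocks (c ∷ w) q []       ()
  prefix-of-blocks w       q (x ∷ xs) e with ++-equidivisible w q (g x) (concatMap g xs) e
  ... | inj₁ (r , refl , e′) with prefix-of-blocks r q xs (sym e′)
  ...   | ys , (t , refl) , r′ , refl , r′≤L =
          x ∷ ys , (t , refl) , r′ , sym (++-assoc (g x) (concatMap g ys) r′) , r′≤L
  prefix-of-blocks w q (x ∷ xs) e | inj₂ (r , gx≡w++r , _) =
    [] , (x ∷ xs , refl) , w , refl , length-prefix-of-block x {w} {r} gx≡w++r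

  Straddles : List A → List B → Set
  Straddles w ys = ∃₂ λ r r′ → w ≡ r ++ concatMap g ys ++ r′ × length r ≤ L × length r′ ≤ L

  factor-of-blocks : {w : List A} (xs : List B) → Factor w (concatMap g xs) →
                     Σ (List B) λ ys → Factor ys xs × Straddles w ys
  factor-of-blocks {[]}    [] _ = [] , ([] , [] , refl) , [] , [] , refl , z≤n , z≤n
  factor-of-blocks {_ ∷ _} [] ([]    , _ , ())
  factor-of-blocks         [] (_ ∷ _ , _ , ())
  factor-of-blocks {w} (x ∷ xs) (p , q , e) with ++-equidivisible p (w ++ q) (g x) (concatMap g xs) e
  ... | inj₁ (r , _ , e′) with factor-of-blocks xs (r , q , sym e′)
  ...   | ys , ys⊑xs , straddle = ys , Factor-∷ x ys⊑xs , straddle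
  factor-of-blocks {w} (x ∷ xs) (p , q , e) | inj₂ (r , gx≡p++r , e′) with ++-equidivisible w q r (concatMap g xs) e′
  ... | inj₁ (r₂ , refl , e″) with prefix-of-blocks r₂ q xs (sym e″)
  ...   | ys , (t , refl) , r′ , refl , r′≤L =
          ys , (x ∷ [] , t , refl) , r , r′ , refl , length-suffix-of-block x {p} {r} gx≡p++r , r′≤L
  factor-of-blocks {w} (x ∷ xs) (p , q , e) | inj₂ (r , gx≡p++r , _) | inj₂ (r₂ , refl , _) =
    [] , ([] , x ∷ xs , refl) , [] , w , refl , z≤n ,
    ≤-trans (length-++-≤ʳ w {p}) (length-prefix-of-block x {p ++ w} {r₂} (trans gx≡p++r (sym (++-assoc p w r₂))))

  length-straddling : {w : List A} {ys : List B} → Straddles w ys → length w ≤ (2 + length ys) * L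
  length-straddling {ys = ys} (r , r′ , refl , r≤L , r′≤L) = begin
    length (r ++ concatMap g ys ++ r′)              ≡⟨ length-++ r {concatMap g ys ++ r′} ⟩
    length r + length (concatMap g ys ++ r′)        ≡⟨ cong (length r +_) (length-++ (concatMap g ys) {r′}) ⟩
    length r + (length (concatMap g ys) + length r′) ≡⟨ cong (λ n → length r + (n + length r′)) (length-concatMap ys) ⟩
    length r + (length ys * L + length r′)          ≤⟨ +-mono-≤ r≤L (+-monoʳ-≤ (length ys * L) r′≤L) ⟩
    L + (length ys * L + L)                         ≡⟨ cong (L +_) (+-comm (length ys * L) L) ⟩
    (2 + length ys) * L                             ∎
    where open ≤-Reasoning

  Factor-concatMap⁻ : {w : List A} (xs : List B) → Factor w (concatMap g xs) →
    Σ (List B) λ ys → Factor ys xs × Factor (concatMap g ys) w × length w ≤ (2 + length ys) * L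
  Factor-concatMap⁻ {w} xs w⊑gxs with factor-of-blocks xs w⊑gxs
  ... | ys , ys⊑xs , straddle@(r , r′ , e , _) = ys , ys⊑xs , (r , r′ , sym e) , length-straddling {w} {ys} straddle

pow-homo : {A C : Set} (h : List A → List C) → h [] ≡ [] → (∀ xs ys → h (xs ++ ys) ≡ h xs ++ h ys) →
           ∀ n w → h (pow n w) ≡ pow n (h w)
pow-homo h h[] h++ zero    w = h[]
pow-homo h h[] h++ (suc n) w = trans (h++ w (pow n w)) (cong (h w ++_) (pow-homo h h[] h++ n w))

Factor-pow : {A : Set} (w : List A) {k : ℕ} → 1 ≤ k → Factor w (pow k w)
Factor-pow w (s≤s _) = Factor-++ˡ w _

words≤ : {A : Set} → List A → ℕ → List (List A)
words≤ as zero    = [] ∷ []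
words≤ as (suc n) = [] ∷ cartesianProductWith _∷_ as (words≤ as n)

∈-words≤ : {A : Set} {as : List A} → (∀ a → a ∈ as) → {n : ℕ} (w : List A) → length w ≤ n → w ∈ words≤ as n
∈-words≤ ∈as {zero}  []      _           = here refl
∈-words≤ ∈as {suc n} []      _           = here refl
∈-words≤ ∈as         (a ∷ w) (s≤s |w|≤n) = there (∈-cartesianProductWith⁺ _∷_ (∈as a) (∈-words≤ ∈as w |w|≤n))

finite-range⇒¬antichain : {A : Set} (R : A → A → Set) → (∀ x → R x x) → (xs : List A) (f : ℕ → A) →
                           (∀ n → f n ∈ xs) → ¬ (∀ i j → i ≢ j → ¬ R (f i) (f j))
finite-range⇒¬antichain R R-refl xs f f∈xs antichain
  with pigeonhole (n<1+n (length xs)) (index ∘ f∈xs ∘ toℕ)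
... | i , j , i<j , same-index = antichain (toℕ i) (toℕ j) (<⇒≢ i<j) (subst (R (f (toℕ i))) fi≡fj (R-refl _))
  where
  fi≡fj : f (toℕ i) ≡ f (toℕ j)
  fi≡fj = begin
    f (toℕ i)                        ≡⟨ lookup-index (f∈xs (toℕ i)) ⟩
    lookup xs (index (f∈xs (toℕ i))) ≡⟨ cong (lookup xs) same-index ⟩
    lookup xs (index (f∈xs (toℕ j))) ≡⟨ sym (lookup-index (f∈xs (toℕ j))) ⟩
    f (toℕ j)                        ∎
    where open ≡-Reasoning

compl-++ : (xs ys : List Bin) → compl (xs ++ ys) ≡ compl xs ++ compl ys
compl-++ = map-++ _

compl-involutive : (w : List Bin) → compl (compl w) ≡ w
compl-involutive []       = refl
compl-involutive (b0 ∷ w) = cong (b0 ∷_) (compl-involutive w)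
compl-involutive (b1 ∷ w) = cong (b1 ∷_) (compl-involutive w)

length-compl : (w : List Bin) → length (compl w) ≡ length w
length-compl = length-map _

block : List Bin → Bin → List Bin
block β b0 = β
block β b1 = compl β

length-block : (β : List Bin) (b : Bin) → length (block β b) ≡ length β
length-block β b0 = refl
length-block β b1 = length-compl β

compl-concatMap-block : (β c : List Bin) → compl (concatMap (block β) c) ≡ concatMap (block β) (compl c)
compl-concatMap-block β []       = refl
compl-concatMap-block β (b0 ∷ c) =
  trans (compl-++ β _) (cong (compl β ++_) (compl-concatMap-block β c))
compl-concatMap-block β (b1 ∷ c) =
  trans (compl-++ (compl β) _) (cong₂ _++_ (compl-involutive β) (compl-concatMap-block β c))

Factor-two-blocks : (P Q : List Bin) → compl (P ++ Q) ≡ Q ++ P →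
                    ∀ a b → Factor (P ++ Q) (block (P ++ Q) a ++ block (P ++ Q) b)
Factor-two-blocks P Q _ b0 b  = Factor-++ˡ (P ++ Q) _
Factor-two-blocks P Q _ b1 b0 = Factor-++ʳ (compl (P ++ Q)) (P ++ Q)
Factor-two-blocks P Q e b1 b1 rewrite e = Q , P , (begin
  Q ++ (P ++ Q) ++ P  ≡⟨ cong (Q ++_) (++-assoc P Q P) ⟩
  Q ++ P ++ Q ++ P    ≡⟨ sym (++-assoc Q P (Q ++ P)) ⟩
  (Q ++ P) ++ Q ++ P  ∎)
  where open ≡-Reasoning

module _ (s : ℕ → ℕ) where

  compl-alphaW-suc : (m : ℕ) → compl (alphaW s (suc m)) ≡ pow (s (suc m)) (compl (alphaW s m)) ++ pow (s (suc m)) (alphaW s m)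
  compl-alphaW-suc m = begin
    compl (pow S α ++ pow S (compl α))             ≡⟨ compl-++ (pow S α) _ ⟩
    compl (pow S α) ++ compl (pow S (compl α))     ≡⟨ cong₂ _++_ (compl-pow S α) (compl-pow S (compl α)) ⟩
    pow S (compl α) ++ pow S (compl (compl α))     ≡⟨ cong (λ w → pow S (compl α) ++ pow S w) (compl-involutive α) ⟩
    pow S (compl α) ++ pow S α                     ∎
    where
    open ≡-Reasoning
    S = s (suc m)
    α = alphaW s m
    compl-pow : ∀ n w → compl (pow n w) ≡ pow n (compl w)
    compl-pow = pow-homo compl refl compl-++

  alphaW-blocks : (m j : ℕ) → ∃ λ c → alphaW s (j + m) ≡ concatMap (block (alphaW s m)) c
  alphaW-blocks m zero    = b0 ∷ [] , sym (++-identityʳ (alphaW s m))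
  alphaW-blocks m (suc j) with alphaW-blocks m j
  ... | c , α≡c = pow S c ++ pow S (compl c) , (begin
    pow S α ++ pow S (compl α)                                     ≡⟨ cong (λ w → pow S w ++ pow S (compl w)) α≡c ⟩
    pow S (concatMap β c) ++ pow S (compl (concatMap β c))          ≡⟨ cong (λ w → pow S (concatMap β c) ++ pow S w) (compl-concatMap-block (alphaW s m) c) ⟩
    pow S (concatMap β c) ++ pow S (concatMap β (compl c))          ≡⟨ sym (cong₂ _++_ (concatMap-pow S c) (concatMap-pow S (compl c))) ⟩
    concatMap β (pow S c) ++ concatMap β (pow S (compl c))          ≡⟨ sym (concatMap-++ β (pow S c) _) ⟩
    concatMap β (pow S c ++ pow S (compl c))                       ∎)
    where
    open ≡-Reasoning
    S = s (suc (j + m))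
    α = alphaW s (j + m)
    β = block (alphaW s m)
    concatMap-pow : ∀ n w → concatMap β (pow n w) ≡ pow n (concatMap β w)
    concatMap-pow = pow-homo (concatMap β) refl (concatMap-++ β)

ρ-letter : Bin → List Step
ρ-letter b0 = d ∷ rd ∷ []
ρ-letter b1 = u ∷ ru ∷ []

length-ρ-letter : (b : Bin) → length (ρ-letter b) ≡ 2
length-ρ-letter b0 = refl
length-ρ-letter b1 = refl

ρ-concatMap : (x : List Bin) → ρ x ≡ concatMap ρ-letter x
ρ-concatMap []       = refl
ρ-concatMap (b0 ∷ x) = cong (λ w → d ∷ rd ∷ w) (ρ-concatMap x)
ρ-concatMap (b1 ∷ x) = cong (λ w → u ∷ ru ∷ w) (ρ-concatMap x)

allSteps : List Step
allSteps = u ∷ d ∷ ru ∷ rd ∷ []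

∈-allSteps : (x : Step) → x ∈ allSteps
∈-allSteps u  = here refl
∈-allSteps d  = there (here refl)
∈-allSteps ru = there (there (here refl))
∈-allSteps rd = there (there (there (here refl)))

module _ (s : ℕ → ℕ) (hs : ∀ k → 1 ≤ k → 1 ≤ s k) where

  alphaW-⊑-suc : (n : ℕ) → Factor (alphaW s n) (alphaW s (suc n))
  alphaW-⊑-suc n = Factor-trans (Factor-pow (alphaW s n) (hs (suc n) (s≤s z≤n))) (Factor-++ˡ _ _)

  alphaW-⊑-mono : {m n : ℕ} → m ≤′ n → Factor (alphaW s m) (alphaW s n)
  alphaW-⊑-mono (≤′-reflexive refl) = Factor-refl _
  alphaW-⊑-mono (≤′-step m≤′n)      = Factor-trans (alphaW-⊑-mono m≤′n) (alphaW-⊑-suc _)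

  module _ (m : ℕ) where
    private
      β : List Bin
      β = alphaW s (suc m)

      module ρ-Blocks = Blocks ρ-letter length-ρ-letter
      module β-Blocks = Blocks (block β) (length-block β)

      ρβ⊑ρ-two-blocks : (a b : Bin) (t : List Bin) → Factor (ρ β) (concatMap ρ-letter (concatMap (block β) (a ∷ b ∷ t)))
      ρβ⊑ρ-two-blocks a b t = subst (λ v → Factor v (concatMap ρ-letter (concatMap (block β) (a ∷ b ∷ t))))
        (sym (ρ-concatMap β)) (Factor-concatMap⁺ ρ-letter
        (Factor-trans (Factor-two-blocks (pow S (alphaW s m)) (pow S (compl (alphaW s m))) (compl-alphaW-suc s m) a b)
                      ([] , concatMap (block β) t , ++-assoc (block β a) (block β b) _)))
        where S = s (suc m)

      length-w-bound : {w : List Step} {y : List Bin} → length w ≤ (2 + length y) * 2 →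
                       length y ≤ 3 * length β → length w ≤ (2 + 3 * length β) * 2
      length-w-bound |w|≤ |y|≤ = ≤-trans |w|≤ (*-monoˡ-≤ 2 (+-monoʳ-≤ 2 |y|≤))

    InP⇒short⊎ρα⊑ : {w : List Step} → InP s w → length w ≤ (2 + 3 * length β) * 2 ⊎ Factor (ρ β) w
    InP⇒short⊎ρα⊑ {w} (x , (n , x⊑αn) , w⊑ρx)
      with ρ-Blocks.Factor-concatMap⁻ x (subst (Factor w) (ρ-concatMap x) w⊑ρx)
    ... | y , y⊑x , ρy⊑w , |w|≤ with alphaW-blocks s (suc m) n
    ... | c , αc≡ with β-Blocks.Factor-concatMap⁻ c
          (subst (Factor y) αc≡ (Factor-trans y⊑x (Factor-trans x⊑αn (alphaW-⊑-mono (≤⇒≤′ (m≤m+n n (suc m)))))))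
    ... | []        , _ , _    , |y|≤ = inj₁ (length-w-bound {w} {y} |w|≤ (≤-trans |y|≤ (*-monoˡ-≤ (length β) (s≤s (s≤s (z≤n {1}))))))
    ... | a ∷ []    , _ , _    , |y|≤ = inj₁ (length-w-bound {w} {y} |w|≤ |y|≤)
    ... | a ∷ b ∷ t , _ , z⊑y , _    = inj₂ (Factor-trans (ρβ⊑ρ-two-blocks a b t) (Factor-trans (Factor-concatMap⁺ ρ-letter z⊑y) ρy⊑w))

proposition7p1 : (s : ℕ → ℕ) → (∀ k → 1 ≤ k → 1 ≤ s k) → ¬ InfiniteAntichainP s
proposition7p1 s hs (f , f∈P , antichain) with f∈P 0
... | x , (m , x⊑αm) , f0⊑ρx =
  finite-range⇒¬antichain Factor Factor-refl (words≤ allSteps bound) (f ∘ suc)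
    (λ j → ∈-words≤ ∈-allSteps (f (suc j)) (short j))
    (λ i j i≢j → antichain (suc i) (suc j) (i≢j ∘ suc-injective))
  where
  f0⊑ρα : Factor (f 0) (ρ (alphaW s (suc m)))
  f0⊑ρα = Factor-trans f0⊑ρx (Factor-concatMap⁺ _ (Factor-trans x⊑αm (alphaW-⊑-suc s hs m)))

  bound : ℕ
  bound = (2 + 3 * length (alphaW s (suc m))) * 2

  short : ∀ j → length (f (suc j)) ≤ bound
  short j = [ id , (λ ρα⊑fj → ⊥-elim (antichain 0 (suc j) (λ ()) (Factor-trans f0⊑ρα ρα⊑fj))) ]′
              (InP⇒short⊎ρα⊑ s hs m (f∈P (suc j)))
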